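{- Let $n\ge2$, $\lambda$ a partition, and suppose $T\in\mathrm{MVT}^n(\lambda)$ is a highest weight element, i.e. $e_iT=0$ for all $i\in\{1,\dots,n-1\}$. Then for each $i$, the $i$-th row of $T$ contains only instances of the letter $i$.
   Context: A multiset-valued tableau of shape $\lambda$ with entries at most $n$ is a filling $T$ of the boxes of the Young diagram of $\lambda$ (English convention) by finite nonempty multisets of integers in $\{1,\dots,n\}$ such that for a box $A$ immediately left of a box $B$ in a row, $\max A\le\min B$, and for a box $C$ immediately below a box $A$ in a column, $\max A<\min C$. $\mathrm{MVT}^n(\lambda)$ is the set of these. Reading word: for a column $C$, $\mathrm{rd}(C)$ first reads the smallest entry of each box, boxes from bottom to top, then the remaining entries of each box (one copy of its minimum removed) from smallest to largest, boxes from top to bottom; $\mathrm{rd}(T)=\mathrm{rd}(C_1)\cdots\mathrm{rd}(C_k)$, columns left to right. For $i\in\{1,\dots,n-1\}$, write $+$ for each letter $i$, $-$ for each letter $i+1$ of $\mathrm{rd}(T)$, cancel pairs $-+$ successively until $+\cdots+-\cdots-$ remains. $e_iT$: $0$ if no uncanceled $-$; else with $\mathsf b$ the box of the leftmost uncanceled $-$: if the box immediately above $\mathsf b$ contains $i$, remove an $i+1$ from $\mathsf b$ and add $i$ to the box above, otherwise replace that $i+1$ in $\mathsf b$ by $i$. -}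

module Defs where

open import Data.Nat using (ℕ; zero; suc; _≤_; _<_; _≥_; _≡ᵇ_; _⊔_; _≤ᵇ_)
open import Data.Bool using (Bool; true; false; if_then_else_)
open import Data.Maybe using (Maybe; just; nothing)
open import Data.Product using (_×_; _,_; proj₁; proj₂)
open import Data.Empty using (⊥)
open import Data.Unit using (⊤)
open import Data.List using (List; []; _∷_; _++_; map; reverse; concatMap; zip; upTo; foldr; length)
open import Data.Bool.ListAction using (any)
open import Data.List.Relation.Unary.All using (All)
open import Data.List.Relation.Unary.Linked using (Linked)
open import Relation.Binary.PropositionalEquality using (_≡_)

IsPartition : List ℕ → Set
IsPartition λ′ = Linked _≥_ λ′ × All (1 ≤_) λ′

-- A box holds a finite nonempty multiset of positive integers, represented
-- canonically as a nonempty weakly increasing list.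
-- A tableau is the list of its rows (top to bottom), each row a list of
-- boxes (left to right); English convention.

Box : Set
Box = List ℕ

Tableau : Set
Tableau = List (List Box)

minB : Box → ℕ
minB []      = 0
minB (x ∷ _) = x

maxB : Box → ℕ
maxB []          = 0
maxB (x ∷ [])    = x
maxB (_ ∷ y ∷ l) = maxB (y ∷ l)

restB : Box → List ℕ
restB []      = []
restB (_ ∷ l) = l

NonEmpty : Box → Set
NonEmpty []      = ⊥
NonEmpty (_ ∷ _) = ⊤

ValidBox : ℕ → Box → Set
ValidBox n A = NonEmpty A × Linked _≤_ A × All (λ x → 1 ≤ x × x ≤ n) A

RowWeak : List Box → Set
RowWeak = Linked (λ A B → maxB A ≤ minB B)

-- column strictness between a row R and the row R′ just below it:
-- max A < min C for C immediately below A (zip truncates to the shorter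
-- row, which is R′ when the shape is a partition)
ColStrict : List Box → List Box → Set
ColStrict R R′ = All (λ p → maxB (proj₁ p) < minB (proj₂ p)) (zip R R′)

shape : Tableau → List ℕ
shape = map length

IsMVT : ℕ → List ℕ → Tableau → Set
IsMVT n λ′ T =
  shape T ≡ λ′ × All (All (ValidBox n)) T × All RowWeak T × Linked ColStrict T

-- Reading word.  Letters are tagged with the position (row , column) of
-- the box they come from (0-based indices).

Pos : Set
Pos = ℕ × ℕ

Letter : Set
Letter = ℕ × Pos

nth : {A : Set} → List A → ℕ → Maybe A
nth []      _       = nothing
nth (x ∷ _) zero    = just x
nth (_ ∷ l) (suc k) = nth l k

columnFrom : ℕ → ℕ → Tableau → List (ℕ × Box)
columnFrom r c []      = []
columnFrom r c (R ∷ T) with nth R c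
... | just A  = (r , A) ∷ columnFrom (suc r) c T
... | nothing = columnFrom (suc r) c T

column : ℕ → Tableau → List (ℕ × Box)
column = columnFrom 0

rdCol : Tableau → ℕ → List Letter
rdCol T c =
  reverse (map (λ { (r , A) → (minB A , (r , c)) }) (column c T))
  ++ concatMap (λ { (r , A) → map (λ x → (x , (r , c))) (restB A) }) (column c T)

numCols : Tableau → ℕ
numCols T = foldr _⊔_ 0 (map length T)

rd : Tableau → List Letter
rd T = concatMap (rdCol T) (upTo (numCols T))

-- Letter i is +, letter i+1 is −; pairs −+ are cancelled
-- successively.  A − is uncancelled iff it is not matched (bracket-wise)
-- with a + to its right.  We scan the word right to left keeping the number
-- of pending (unmatched) +'s; the last uncancelled − met is the leftmost.

scanMinus : ℕ → ℕ → List Letter → Maybe Pos → Maybe Pos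
scanMinus i k []             acc = acc
scanMinus i k ((x , p) ∷ w)  acc =
  if x ≡ᵇ i then scanMinus i (suc k) w acc
  else if x ≡ᵇ suc i then step k
  else scanMinus i k w acc
  where
    step : ℕ → Maybe Pos
    step zero    = scanMinus i zero w (just p)
    step (suc j) = scanMinus i j w acc

leftmostMinus : ℕ → Tableau → Maybe Pos
leftmostMinus i T = scanMinus i 0 (reverse (rd T)) nothing

insertB : ℕ → Box → Box
insertB x []      = x ∷ []
insertB x (y ∷ l) = if x ≤ᵇ y then x ∷ y ∷ l else y ∷ insertB x l

removeB : ℕ → Box → Box
removeB x []      = []
removeB x (y ∷ l) = if x ≡ᵇ y then l else y ∷ removeB x l

containsB : ℕ → Box → Bool
containsB x A = any (λ y → y ≡ᵇ x) A

modifyAt : {A : Set} → ℕ → (A → A) → List A → List A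
modifyAt _       f []      = []
modifyAt zero    f (x ∷ l) = f x ∷ l
modifyAt (suc k) f (x ∷ l) = x ∷ modifyAt k f l

modifyBox : Pos → (Box → Box) → Tableau → Tableau
modifyBox (r , c) f = modifyAt r (modifyAt c f)

boxAt : Tableau → Pos → Maybe Box
boxAt T (r , c) with nth T r
... | just R  = nth R c
... | nothing = nothing

aboveContains : ℕ → Tableau → Pos → Bool
aboveContains i T (zero  , c) = false
aboveContains i T (suc r , c) with boxAt T (r , c)
... | just A  = containsB i A
... | nothing = false

applyE : ℕ → Tableau → Pos → Tableau
applyE i T (r , c) with aboveContains i T (r , c)
applyE i T (zero  , c) | _ = modifyBox (zero , c) (λ A → insertB i (removeB (suc i) A)) T
applyE i T (suc r , c) | true =
  modifyBox (r , c) (insertB i) (modifyBox (suc r , c) (removeB (suc i)) T)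
applyE i T (suc r , c) | false =
  modifyBox (suc r , c) (λ A → insertB i (removeB (suc i) A)) T

-- e_i T ; 'nothing' stands for 0
e : ℕ → Tableau → Maybe Tableau
e i T with leftmostMinus i T
... | nothing = nothing
... | just p  = just (applyE i T p)

RowsFrom : ℕ → Tableau → Set
RowsFrom k []      = ⊤
RowsFrom k (R ∷ T) = All (All (_≡ k)) R × RowsFrom (suc k) T

RowsOnlyOwnIndex : Tableau → Set
RowsOnlyOwnIndex = RowsFrom 1

-- Induction on the letter: assume every i in T lies in row i. If some i+1 lay in a row
-- above row i+1, every i would be weakly below it, hence (by monotonicity of the tableau)
-- neither strictly right of it nor strictly below it in its column, and not in its column
-- at all when that i+1 is the minimum of its box. So in the reading word this i+1 is
-- followed by no i: its − is never cancelled, and e_i T ≠ 0.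
module Submission where

open import Defs
open import Data.Nat using (ℕ; zero; suc; _+_; _≤_; _<_; _≥_; _≡ᵇ_; _≤′_; ≤′-refl; ≤′-step; z≤n; s≤s; s≤s⁻¹; s<s⁻¹)
open import Data.Nat.Properties
open import Data.Bool using (true; false) renaming (T to True)
open import Data.Maybe using (Maybe; just; nothing)
open import Data.Maybe.Properties using (just-injective)
open import Data.Product using (_×_; _,_; proj₁; proj₂; ∃; ∃-syntax)
open import Data.Sum using (inj₁; inj₂)
open import Data.Empty using (⊥-elim)
open import Data.Unit using (tt)
open import Data.List using (List; []; _∷_; _++_; [_]; map; reverse; concatMap; zip; upTo; length; _∷ʳ_)
open import Data.List.Properties using (++-assoc; unfold-reverse)
open import Data.List.Relation.Unary.All as All using (All; []; _∷_)
open import Data.List.Relation.Unary.All.Properties using (++⁺; map⁺; concat⁺)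
open import Data.List.Relation.Unary.AllPairs using (AllPairs; []; _∷_)
import Data.List.Relation.Unary.AllPairs.Properties as AllPairs
open import Data.List.Relation.Unary.Any using (here; there)
open import Data.List.Relation.Unary.Any.Properties using (reverse⁺; reverse⁻)
open import Data.List.Relation.Unary.Linked as Linked using (Linked; []; [-]; _∷_)
open import Data.List.Relation.Unary.Linked.Properties using (Linked⇒All)
open import Data.List.Membership.Propositional using (_∈_; _∉_)
open import Data.List.Membership.Propositional.Properties using (∈-map⁺; ∈-++⁺ˡ; ∈-upTo⁺)
open import Function using (id; _∘_)
open import Relation.Binary.PropositionalEquality using (_≡_; _≢_; refl; sym; trans; cong; subst; module ≡-Reasoning)
open import Relation.Nullary using (yes; no)

module _ {A : Set} where

  All-nth : ∀ {P : A → Set} {xs k x} → All P xs → nth xs k ≡ just x → P x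
  All-nth {k = zero}  (px ∷ _)  refl = px
  All-nth {k = suc k} (_ ∷ pxs) eq   = All-nth pxs eq

  nth-All : ∀ {P : A → Set} (xs : List A) → (∀ k {x} → nth xs k ≡ just x → P x) → All P xs
  nth-All []       _ = []
  nth-All (x ∷ xs) h = h 0 refl ∷ nth-All xs (λ k → h (suc k))

  nth-<-length : ∀ (xs : List A) {k x} → nth xs k ≡ just x → k < length xs
  nth-<-length (_ ∷ _)  {zero}  _  = s≤s z≤n
  nth-<-length (_ ∷ xs) {suc k} eq = s≤s (nth-<-length xs eq)

  <-length-nth : ∀ (xs : List A) k → k < length xs → ∃ λ x → nth xs k ≡ just x
  <-length-nth (x ∷ _)  zero    _         = x , refl
  <-length-nth (_ ∷ xs) (suc k) (s≤s k<l) = <-length-nth xs k k<l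

  Linked-nth : ∀ {R : A → A → Set} {xs} k {x y} →
               Linked R xs → nth xs k ≡ just x → nth xs (suc k) ≡ just y → R x y
  Linked-nth zero    (r ∷ _)  refl refl = r
  Linked-nth (suc k) (_ ∷ rs) eq   eq′  = Linked-nth k rs eq eq′
  Linked-nth zero    [-]      _    ()
  Linked-nth (suc k) [-]      ()   _

  All-reverse : ∀ {P : A → Set} {xs} → All P xs → All P (reverse xs)
  All-reverse ps = All.tabulate (λ x∈ → All.lookup ps (reverse⁻ x∈))

All-zip-nth : ∀ {A B : Set} {P : A × B → Set} (xs : List A) (ys : List B) k {x y} →
              All P (zip xs ys) → nth xs k ≡ just x → nth ys k ≡ just y → P (x , y)
All-zip-nth (_ ∷ _)  (_ ∷ _)  zero    (p ∷ _)  refl refl = p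
All-zip-nth (_ ∷ xs) (_ ∷ ys) (suc k) (_ ∷ ps) eq   eq′  = All-zip-nth xs ys k ps eq eq′

≤-maxB : ∀ {A y} → Linked _≤_ A → y ∈ A → y ≤ maxB A
≤-maxB {_ ∷ []}    _              (here refl) = ≤-refl
≤-maxB {_ ∷ _ ∷ _} (x≤x′ ∷ sorted) (here refl) = ≤-trans x≤x′ (≤-maxB sorted (here refl))
≤-maxB {_ ∷ _ ∷ _} (_ ∷ sorted)    (there y∈)  = ≤-maxB sorted y∈

minB-≤ : ∀ {A y} → Linked _≤_ A → y ∈ A → minB A ≤ y
minB-≤ {_ ∷ _} sorted = All.lookup (Linked⇒All ≤-trans ≤-refl sorted)

minB-∈ : ∀ {A} → NonEmpty A → minB A ∈ A
minB-∈ {_ ∷ _} _ = here refl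

restB-⊆ : ∀ {A y} → y ∈ restB A → y ∈ A
restB-⊆ {_ ∷ _} = there

∈-restB : ∀ {A y} → y ∈ A → y ≢ minB A → y ∈ restB A
∈-restB (here refl) y≢min = ⊥-elim (y≢min refl)
∈-restB (there y∈)  _     = y∈

restB-sorted : ∀ {A} → Linked _≤_ A → Linked _≤_ (restB A)
restB-sorted {[]}    _      = []
restB-sorted {_ ∷ _} sorted = Linked.tail sorted

-- Rows and columns are counted from 0, as in Pos.
cell : Tableau → ℕ → ℕ → Maybe Box
cell []      _       _ = nothing
cell (R ∷ _) zero    c = nth R c
cell (_ ∷ T) (suc ρ) c = cell T ρ c

cell-All : ∀ {P : Box → Set} T {ρ c A} → All (All P) T → cell T ρ c ≡ just A → P A
cell-All (_ ∷ _) {zero}  (ps ∷ _)  eq = All-nth ps eq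
cell-All (_ ∷ T) {suc ρ} (_ ∷ pss) eq = cell-All T pss eq

cell-unique : ∀ T {ρ c A B} → cell T ρ c ≡ just A → cell T ρ c ≡ just B → A ≡ B
cell-unique _ eA eB = just-injective (trans (sym eA) eB)

cell-left : ∀ T {ρ c c′ B} → c ≤ c′ → cell T ρ c′ ≡ just B → ∃ λ A → cell T ρ c ≡ just A
cell-left (R ∷ _) {zero} {c} c≤c′ eB = <-length-nth R c (≤-<-trans c≤c′ (nth-<-length R eB))
cell-left (_ ∷ T) {suc ρ} c≤c′ eB = cell-left T c≤c′ eB

cell-up : ∀ T {ρ c B} → Linked _≥_ (shape T) → cell T (suc ρ) c ≡ just B → ∃ λ A → cell T ρ c ≡ just A
cell-up (R ∷ R′ ∷ _) {zero} {c} (R≥R′ ∷ _) eB = <-length-nth R c (<-≤-trans (nth-<-length R′ eB) R≥R′)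
cell-up (_ ∷ T)      {suc ρ} decreasing eB = cell-up T (Linked.tail decreasing) eB

cell-row-step : ∀ T {ρ c A B} → All RowWeak T →
                cell T ρ c ≡ just A → cell T ρ (suc c) ≡ just B → maxB A ≤ minB B
cell-row-step (R ∷ _) {zero}  {c} (weak ∷ _) = Linked-nth c weak
cell-row-step (_ ∷ T) {suc ρ}     (_ ∷ rows) = cell-row-step T rows

cell-column-step : ∀ T {ρ c A B} → Linked ColStrict T →
                   cell T ρ c ≡ just A → cell T (suc ρ) c ≡ just B → maxB A < minB B
cell-column-step (R ∷ R′ ∷ _) {zero}  {c} (strict ∷ _) = All-zip-nth R R′ c strict
cell-column-step (_ ∷ T)      {suc ρ}     columns      = cell-column-step T (Linked.tail columns)

cell-column<numCols : ∀ T {ρ c A} → cell T ρ c ≡ just A → c < numCols T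
cell-column<numCols (R ∷ _) {zero}  eA = ≤-trans (nth-<-length R eA) (m≤m⊔n (length R) _)
cell-column<numCols (R ∷ T) {suc ρ} eA = ≤-trans (cell-column<numCols T eA) (m≤n⊔m (length R) _)

module _ (c : ℕ) where

  InColumnFrom : ℕ → Tableau → ℕ × Box → Set
  InColumnFrom r T q = ∃ λ k → proj₁ q ≡ r + k × cell T k c ≡ just (proj₂ q)

  InColumnFrom-∷ : ∀ {r R T q} → InColumnFrom (suc r) T q → InColumnFrom r (R ∷ T) q
  InColumnFrom-∷ {r} (k , eq , eA) = suc k , trans eq (sym (+-suc r k)) , eA

  columnFrom-sound : ∀ r T → All (InColumnFrom r T) (columnFrom r c T)
  columnFrom-sound r []      = []
  columnFrom-sound r (R ∷ T) with nth R c in eA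
  ... | just _  = (0 , sym (+-identityʳ r) , eA) ∷ All.map InColumnFrom-∷ (columnFrom-sound (suc r) T)
  ... | nothing = All.map InColumnFrom-∷ (columnFrom-sound (suc r) T)

  columnFrom-ascending : ∀ r T → AllPairs (λ q q′ → proj₁ q < proj₁ q′) (columnFrom r c T)
  columnFrom-ascending r []      = []
  columnFrom-ascending r (R ∷ T) with nth R c
  ... | just _  = All.map (λ { (k , refl , _) → s≤s (m≤m+n r k) }) (columnFrom-sound (suc r) T)
                  ∷ columnFrom-ascending (suc r) T
  ... | nothing = columnFrom-ascending (suc r) T

  ∈-columnFrom : ∀ r T k {A} → cell T k c ≡ just A → (r + k , A) ∈ columnFrom r c T
  ∈-columnFrom r (R ∷ T) zero    eA with nth R c | eA
  ... | just _ | refl = here (cong (_, _) (+-identityʳ r))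
  ∈-columnFrom r (R ∷ T) (suc k) {A} eA with nth R c
  ... | just _  = there (subst (λ ρ → (ρ , A) ∈ columnFrom (suc r) c T) (sym (+-suc r k)) (∈-columnFrom (suc r) T k eA))
  ... | nothing = subst (λ ρ → (ρ , A) ∈ columnFrom (suc r) c T) (sym (+-suc r k)) (∈-columnFrom (suc r) T k eA)

  column-cells : ∀ T → All (λ q → cell T (proj₁ q) c ≡ just (proj₂ q)) (column c T)
  column-cells T = All.map (λ { (_ , refl , eA) → eA }) (columnFrom-sound 0 T)

  column-∈ : ∀ T {ρ A} → cell T ρ c ≡ just A → (ρ , A) ∈ column c T
  column-∈ T = ∈-columnFrom 0 T _

NoLetter : ℕ → List Letter → Set
NoLetter i = All (λ a → proj₁ a ≢ i)

-- The − of the i+1 at the head of 'now' has no + to its right to cancel with.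
data Uncancelled (i : ℕ) : List Letter → Set where
  now   : ∀ {p w} → NoLetter i w → Uncancelled i ((suc i , p) ∷ w)
  later : ∀ {a w} → Uncancelled i w → Uncancelled i (a ∷ w)

uncancelled-++ˡ : ∀ {i w} u → Uncancelled i w → Uncancelled i (u ++ w)
uncancelled-++ˡ []      u = u
uncancelled-++ˡ (_ ∷ v) u = later (uncancelled-++ˡ v u)

uncancelled-++ʳ : ∀ {i w w′} → Uncancelled i w → NoLetter i w′ → Uncancelled i (w ++ w′)
uncancelled-++ʳ (now none) none′ = now (++⁺ none none′)
uncancelled-++ʳ (later u)  none′ = later (uncancelled-++ʳ u none′)

uncancelled-∈ : ∀ {i x p w} → (x , p) ∈ w → x ≡ suc i → NoLetter i w → Uncancelled i w
uncancelled-∈ (here refl) refl (_ ∷ none) = now none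
uncancelled-∈ (there a∈)  eq   (_ ∷ none) = later (uncancelled-∈ a∈ eq none)

uncancelled-sorted : ∀ {i} p {xs} → Linked _≤_ xs → suc i ∈ xs → Uncancelled i (map (λ x → x , p) xs)
uncancelled-sorted {i} p sorted (here refl) =
  now (map⁺ (All.tabulate λ y∈ y≡i →
    1+n≰n (subst (suc i ≤_) y≡i (All.lookup (Linked⇒All ≤-trans ≤-refl sorted) (there y∈)))))
uncancelled-sorted p sorted (there x∈) = later (uncancelled-sorted p (Linked.tail sorted) x∈)

uncancelled-concatMap : ∀ {i} {A : Set} {R : A → A → Set} {f : A → List Letter} {xs x} →
  AllPairs R xs → x ∈ xs → Uncancelled i (f x) →
  (∀ {y} → y ∈ xs → R x y → NoLetter i (f y)) → Uncancelled i (concatMap f xs)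
uncancelled-concatMap (Rx ∷ _) (here refl) u after =
  uncancelled-++ʳ u (concat⁺ (map⁺ (All.tabulate λ y∈ → after (there y∈) (All.lookup Rx y∈))))
uncancelled-concatMap {f = f} {xs = y ∷ _} (_ ∷ pairs) (there x∈) u after =
  uncancelled-++ˡ (f y) (uncancelled-concatMap pairs x∈ u (λ y∈ → after (there y∈)))

reverse-uncancelled : ∀ {i w} → Uncancelled i w →
  ∃[ α ] ∃[ p ] ∃[ β ] reverse w ≡ α ++ (suc i , p) ∷ β × NoLetter i α
reverse-uncancelled (now {p} {w} none) = reverse w , p , [] , unfold-reverse _ w , All-reverse none
reverse-uncancelled {i} (later {a} {w} u) with α , p , β , eq , none ← reverse-uncancelled u =
  α , p , β ∷ʳ a , reversed , none
  where
    open ≡-Reasoning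
    reversed : reverse (a ∷ w) ≡ α ++ (suc i , p) ∷ β ∷ʳ a
    reversed = begin
      reverse (a ∷ w)               ≡⟨ unfold-reverse a w ⟩
      reverse w ∷ʳ a                ≡⟨ cong (_∷ʳ a) eq ⟩
      (α ++ (suc i , p) ∷ β) ∷ʳ a   ≡⟨ ++-assoc α _ [ a ] ⟩
      α ++ (suc i , p) ∷ β ∷ʳ a     ∎

≡ᵇ-refl : ∀ i → (i ≡ᵇ i) ≡ true
≡ᵇ-refl zero    = refl
≡ᵇ-refl (suc i) = ≡ᵇ-refl i

suc-≡ᵇ-false : ∀ i → (suc i ≡ᵇ i) ≡ false
suc-≡ᵇ-false zero    = refl
suc-≡ᵇ-false (suc i) = suc-≡ᵇ-false i

scanMinus-just≢nothing : ∀ i k w q → scanMinus i k w (just q) ≢ nothing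
scanMinus-just≢nothing i k [] q ()
scanMinus-just≢nothing i k ((x , p) ∷ w) q with x ≡ᵇ i
... | true = scanMinus-just≢nothing i (suc k) w q
... | false with x ≡ᵇ suc i
...   | false = scanMinus-just≢nothing i k w q
scanMinus-just≢nothing i zero    ((x , p) ∷ w) q | false | true = scanMinus-just≢nothing i zero w p
scanMinus-just≢nothing i (suc k) ((x , p) ∷ w) q | false | true = scanMinus-just≢nothing i k w q

-- α holds no +, so no + is pending when the first − of the reversed word is met.
scanMinus-uncancelled : ∀ i α p β acc → NoLetter i α → scanMinus i 0 (α ++ (suc i , p) ∷ β) acc ≢ nothing
scanMinus-uncancelled i [] p β acc _ rewrite suc-≡ᵇ-false i | ≡ᵇ-refl (suc i) =
  scanMinus-just≢nothing i 0 β p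
scanMinus-uncancelled i ((x , q) ∷ α) p β acc (x≢i ∷ none) with x ≡ᵇ i in x≡ᵇi
... | true = ⊥-elim (x≢i (≡ᵇ⇒≡ x i (subst True (sym x≡ᵇi) tt)))
... | false with x ≡ᵇ suc i
...   | true  = scanMinus-just≢nothing i 0 (α ++ (suc i , p) ∷ β) q
...   | false = scanMinus-uncancelled i α p β acc none

leftmostMinus-uncancelled : ∀ {i} T → Uncancelled i (rd T) → leftmostMinus i T ≢ nothing
leftmostMinus-uncancelled {i} T u with α , p , β , eq , none ← reverse-uncancelled u =
  subst (λ w → scanMinus i 0 w nothing ≢ nothing) (sym eq) (scanMinus-uncancelled i α p β nothing none)

e≢nothing : ∀ {i} T → Uncancelled i (rd T) → e i T ≢ nothing
e≢nothing {i} T u with leftmostMinus i T in lm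
... | nothing = ⊥-elim (leftmostMinus-uncancelled T u lm)
... | just _  = λ ()

IsHighestWeight : ℕ → Tableau → Set
IsHighestWeight n T = ∀ i → 1 ≤ i → i < n → e i T ≡ nothing

module MVT {n : ℕ} {T : Tableau}
  (decreasing : Linked _≥_ (shape T))
  (boxes      : All (All (ValidBox n)) T)
  (rows       : All RowWeak T)
  (columns    : Linked ColStrict T)
  where

  open ≤-Reasoning

  private
    variable
      i ρ ρ′ c c′ y z : ℕ
      A B : Box

  valid : cell T ρ c ≡ just A → ValidBox n A
  valid = cell-All T boxes

  sorted : cell T ρ c ≡ just A → Linked _≤_ A
  sorted = proj₁ ∘ proj₂ ∘ valid

  entry-bounds : cell T ρ c ≡ just A → y ∈ A → 1 ≤ y × y ≤ n
  entry-bounds eA = All.lookup (proj₂ (proj₂ (valid eA)))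

  minB-∈-cell : cell T ρ c ≡ just A → minB A ∈ A
  minB-∈-cell = minB-∈ ∘ proj₁ ∘ valid

  entry-≤-maxB : cell T ρ c ≡ just A → y ∈ A → y ≤ maxB A
  entry-≤-maxB = ≤-maxB ∘ sorted

  minB-≤-entry : cell T ρ c ≡ just A → y ∈ A → minB A ≤ y
  minB-≤-entry = minB-≤ ∘ sorted

  minB-≤-maxB : cell T ρ c ≡ just A → minB A ≤ maxB A
  minB-≤-maxB eA = entry-≤-maxB eA (minB-∈-cell eA)

  cell-above : ρ ≤′ ρ′ → cell T ρ′ c ≡ just B → ∃ λ A → cell T ρ c ≡ just A
  cell-above ≤′-refl       eB = _ , eB
  cell-above (≤′-step ρ≤′) eB with _ , eD ← cell-up T decreasing eB = cell-above ρ≤′ eD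

  minB-mono-right : c ≤′ c′ → cell T ρ c ≡ just A → cell T ρ c′ ≡ just B → minB A ≤ minB B
  minB-mono-right ≤′-refl eA eB = ≤-reflexive (cong minB (cell-unique T eA eB))
  minB-mono-right {A = A} {B = B} (≤′-step c≤′) eA eB with D , eD ← cell-left T (n≤1+n _) eB = begin
    minB A ≤⟨ minB-mono-right c≤′ eA eD ⟩
    minB D ≤⟨ minB-≤-maxB eD ⟩
    maxB D ≤⟨ cell-row-step T rows eD eB ⟩
    minB B ∎

  minB-mono-down : ρ ≤′ ρ′ → cell T ρ c ≡ just A → cell T ρ′ c ≡ just B → minB A ≤ minB B
  minB-mono-down ≤′-refl eA eB = ≤-reflexive (cong minB (cell-unique T eA eB))
  minB-mono-down {A = A} {B = B} (≤′-step ρ≤′) eA eB with D , eD ← cell-up T decreasing eB = begin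
    minB A ≤⟨ minB-mono-down ρ≤′ eA eD ⟩
    minB D ≤⟨ minB-≤-maxB eD ⟩
    maxB D <⟨ cell-column-step T columns eD eB ⟩
    minB B ∎

  entry-<-strictly-below : ρ < ρ′ → c ≤ c′ → cell T ρ c ≡ just A → cell T ρ′ c′ ≡ just B →
                           y ∈ A → z ∈ B → y < z
  entry-<-strictly-below {A = A} {B = B} {y = y} {z = z} ρ<ρ′ c≤c′ eA eB y∈ z∈
    with D , eD ← cell-left T c≤c′ eB
    with E , eE ← cell-above (≤⇒≤′ ρ<ρ′) eD = begin-strict
      y      ≤⟨ entry-≤-maxB eA y∈ ⟩
      maxB A <⟨ cell-column-step T columns eA eE ⟩
      minB E ≤⟨ minB-mono-down (≤⇒≤′ ρ<ρ′) eE eD ⟩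
      minB D ≤⟨ minB-mono-right (≤⇒≤′ c≤c′) eD eB ⟩
      minB B ≤⟨ minB-≤-entry eB z∈ ⟩
      z      ∎

  entry-≤-strictly-right : ρ ≤ ρ′ → c < c′ → cell T ρ c ≡ just A → cell T ρ′ c′ ≡ just B →
                           y ∈ A → z ∈ B → y ≤ z
  entry-≤-strictly-right {A = A} {B = B} {y = y} {z = z} ρ≤ρ′ c<c′ eA eB y∈ z∈
    with D , eD ← cell-above (≤⇒≤′ ρ≤ρ′) eB
    with E , eE ← cell-left T c<c′ eD = begin
      y      ≤⟨ entry-≤-maxB eA y∈ ⟩
      maxB A ≤⟨ cell-row-step T rows eA eE ⟩
      minB E ≤⟨ minB-mono-right (≤⇒≤′ c<c′) eE eD ⟩
      minB D ≤⟨ minB-mono-down (≤⇒≤′ ρ≤ρ′) eD eB ⟩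
      minB B ≤⟨ minB-≤-entry eB z∈ ⟩
      z      ∎

  row<entry : cell T ρ c ≡ just A → y ∈ A → ρ < y
  row<entry {ρ = zero}  eA y∈ = proj₁ (entry-bounds eA y∈)
  row<entry {ρ = suc ρ} {A = A} {y = y} eA y∈ with D , eD ← cell-up T decreasing eA = begin-strict
    suc ρ  ≤⟨ row<entry eD (minB-∈-cell eD) ⟩
    minB D ≤⟨ minB-≤-maxB eD ⟩
    maxB D <⟨ cell-column-step T columns eD eA ⟩
    minB A ≤⟨ minB-≤-entry eA y∈ ⟩
    y      ∎

  column-noLetter : (∀ {ρ A} → cell T ρ c ≡ just A → i ∉ A) → NoLetter i (rdCol T c)
  column-noLetter {c} {i} free =
    ++⁺ (All-reverse (map⁺ (All.map minB≢i (column-cells c T))))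
        (concat⁺ (map⁺ (All.map restB≢i (column-cells c T))))
    where
      minB≢i : ∀ {q} → cell T (proj₁ q) c ≡ just (proj₂ q) → minB (proj₂ q) ≢ i
      minB≢i eA min≡i = free eA (subst (_∈ _) min≡i (minB-∈-cell eA))
      restB≢i : ∀ {q} → cell T (proj₁ q) c ≡ just (proj₂ q) →
                NoLetter i (map (λ x → x , proj₁ q , c) (restB (proj₂ q)))
      restB≢i eA = map⁺ (All.tabulate λ x∈ x≡i → free eA (subst (_∈ _) x≡i (restB-⊆ x∈)))

  OwnRow : ℕ → Set
  OwnRow x = ∀ {ρ c A} → cell T ρ c ≡ just A → x ∈ A → suc ρ ≡ x

  module Misplaced {i ρ c A} (i-own-row : OwnRow i) (eA : cell T ρ c ≡ just A) (i+1∈A : suc i ∈ A) (ρ<i : ρ < i) where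

    i-weakly-below : cell T ρ′ c′ ≡ just B → i ∈ B → ρ ≤ ρ′
    i-weakly-below eB i∈ = s≤s⁻¹ (subst (ρ <_) (sym (i-own-row eB i∈)) ρ<i)

    no-i-strictly-below : cell T ρ′ c ≡ just B → ρ < ρ′ → i ∉ B
    no-i-strictly-below eB ρ<ρ′ i∈ = 1+n≰n (<⇒≤ (entry-<-strictly-below ρ<ρ′ ≤-refl eA eB i+1∈A i∈))

    no-i-right : c < c′ → NoLetter i (rdCol T c′)
    no-i-right c<c′ = column-noLetter λ eB i∈ →
      1+n≰n (entry-≤-strictly-right (i-weakly-below eB i∈) c<c′ eA eB i+1∈A i∈)

    no-i-in-column : minB A ≡ suc i → cell T ρ′ c ≡ just B → i ∉ B
    no-i-in-column min≡ eB i∈ with m≤n⇒m<n∨m≡n (i-weakly-below eB i∈)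
    ... | inj₁ ρ<ρ′ = no-i-strictly-below eB ρ<ρ′ i∈
    ... | inj₂ refl = 1+n≰n (subst (_≤ i) min≡ (minB-≤-entry eA (subst (i ∈_) (cell-unique T eB eA) i∈)))

    -- The i+1 is read among the minima if it is the minimum of its box, else among the
    -- remaining entries, which are followed only by those of the boxes below.
    column-uncancelled : Uncancelled i (rdCol T c)
    column-uncancelled with minB A ≟ suc i
    ... | yes min≡ = uncancelled-∈ (∈-++⁺ˡ (reverse⁺ (∈-map⁺ _ (column-∈ c T eA)))) min≡
                                   (column-noLetter (no-i-in-column min≡))
    ... | no min≢ =
      uncancelled-++ˡ (reverse (map _ (column c T)))
        (uncancelled-concatMap (columnFrom-ascending c 0 T) (column-∈ c T eA)
          (uncancelled-sorted (ρ , c) (restB-sorted (sorted eA)) (∈-restB i+1∈A (min≢ ∘ sym)))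
          rest-below)
      where
        rest-below : ∀ {q} → q ∈ column c T → ρ < proj₁ q →
                     NoLetter i (map (λ x → x , proj₁ q , c) (restB (proj₂ q)))
        rest-below q∈ ρ<ρ′ = map⁺ (All.tabulate λ x∈ x≡i →
          no-i-strictly-below (All.lookup (column-cells c T) q∈) ρ<ρ′ (subst (_∈ _) x≡i (restB-⊆ x∈)))

    rd-uncancelled : Uncancelled i (rd T)
    rd-uncancelled =
      uncancelled-concatMap (AllPairs.applyUpTo⁺₁ id (numCols T) (λ c<c′ _ → c<c′))
        (∈-upTo⁺ (cell-column<numCols T eA)) column-uncancelled (λ _ → no-i-right)

  ownRow : IsHighestWeight n T → ∀ x → OwnRow x
  ownRow _       zero    eA x∈ = ⊥-elim (1+n≰n (proj₁ (entry-bounds eA x∈)))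
  ownRow highest (suc i) eA i+1∈ with m≤n⇒m<n∨m≡n (row<entry eA i+1∈)
  ... | inj₂ inOwnRow  = inOwnRow
  ... | inj₁ misplaced =
    ⊥-elim (e≢nothing T (Misplaced.rd-uncancelled (ownRow highest i) eA i+1∈ ρ<i)
                        (highest i (≤-trans (s≤s z≤n) ρ<i) (proj₂ (entry-bounds eA i+1∈))))
    where ρ<i = s<s⁻¹ misplaced

rowsFrom-cells : ∀ k T → (∀ {ρ c A y} → cell T ρ c ≡ just A → y ∈ A → y ≡ k + ρ) → RowsFrom k T
rowsFrom-cells k []      _ = tt
rowsFrom-cells k (R ∷ T) h =
  nth-All R (λ c eA → All.tabulate λ y∈ → trans (h {0} eA y∈) (+-identityʳ k)) ,
  rowsFrom-cells (suc k) T (λ {ρ} eA y∈ → trans (h {suc ρ} eA y∈) (+-suc k ρ))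

proposition3p10 : (n : ℕ) → 2 ≤ n → (λ′ : List ℕ) → IsPartition λ′ →
    (T : Tableau) → IsMVT n λ′ T →
    ((i : ℕ) → 1 ≤ i → i < n → e i T ≡ nothing) →
    RowsOnlyOwnIndex T
proposition3p10 n _ λ′ (decreasing , _) T (refl , boxes , rows , columns) highest =
  rowsFrom-cells 1 T λ eA y∈ → sym (MVT.ownRow decreasing boxes rows columns highest _ eA y∈)
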